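{- Let $n>3$, let $\mathfrak N$ be a $\big(\binom n2_{n-2}\binom n3_3\big)$-configuration on $\wp_2(I_n)$, let $\Phi=(\phi_n,\dots,\phi_3)$ with $\phi_j\in\mathcal S_{I_{j-1}}$, and let $\mathfrak M=\Pi(n,\sigma_\Phi,\mathfrak N)$. Let $k\in I_n$, $k>3$. The following are equivalent: (i) for every $i\in I_n$, $i\neq k$, there is $j\in I_n$, $j\ne k$, such that the line of $\mathfrak M$ through $a_k,a_i$ and the line of $\mathfrak M$ through $b_k,b_j$ have a common point; (ii) $k=n$, or $k<n$ and $\phi_j(k)=k$ for all $j$ with $k<j\le n$.
   Context: $I_m=\{1,\dots,m\}$, $\wp_k(X)$ the $k$-subsets of $X$, $\mathcal S_X$ the permutations of $X$. A $\big(\binom n2_{n-2}\binom n3_3\big)$-configuration: $\binom n2$ points each on $n-2$ lines, $\binom n3$ lines of size 3, two lines sharing at most one point. $\sigma_\Phi(\{i,j\})=\{j,\phi_j(i)\}$ for $1\le i<j\le n$, with $\phi_2=\mathrm{id}_{\{1\}}$. $\Pi(n,\sigma,\mathfrak N)$ has pairwise distinct points $a_i,b_i$ ($i\in I_n$), $p$, $c_u$ ($u\in\wp_2(I_n)$) and lines $\{p,a_i,b_i\}$, $\{a_i,a_j,c_{\{i,j\}}\}$, $\{b_i,b_j,c_{\sigma^{ -1}(\{i,j\})}\}$, and $\{c_u,c_v,c_w\}$ for every line $\{u,v,w\}$ of $\mathfrak N$. -}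

module Defs where

open import Data.Nat as ℕ using (ℕ; zero; suc; _∸_)
open import Data.Nat.Combinatorics using (_C_)
open import Data.Fin as Fin using (Fin; toℕ; inject; fromℕ<)
open import Data.Fin.Properties using (toℕ-inject; toℕ<n)
open import Data.Fin.Permutation using (Permutation′; _⟨$⟩ʳ_; _⟨$⟩ˡ_)
open import Data.List using (List; length; filter; lookup)
open import Data.Product using (Σ; ∃; _×_; _,_)
open import Data.Sum using (_⊎_)
open import Relation.Binary.PropositionalEquality using (_≡_; _≢_; refl; subst; sym)
open import Relation.Nullary using (Dec; yes; no; ¬_)
open import Relation.Nullary.Decidable using (_⊎-dec_)

-- Convention: I_n = {1,…,n} is represented by Fin n, the element i ∈ I_n
-- being the Fin n value with toℕ = i - 1.

record Pair (n : ℕ) : Set where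
  constructor pair
  field
    lo  : Fin n
    hi  : Fin n
    .lt : lo Fin.< hi
open Pair public

_≟ᴾ_ : ∀ {n} (u v : Pair n) → Dec (u ≡ v)
pair l h _ ≟ᴾ pair l' h' _ with l Fin.≟ l' | h Fin.≟ h'
... | yes refl | yes refl = yes refl
... | no ¬p    | _        = no λ { refl → ¬p refl }
... | yes _    | no ¬q    = no λ { refl → ¬q refl }

record Triple (n : ℕ) : Set where
  constructor triple
  field
    t₁ t₂ t₃ : Pair n
open Triple public

_∈₃_ : ∀ {n} → Pair n → Triple n → Set
x ∈₃ t = x ≡ t₁ t ⊎ x ≡ t₂ t ⊎ x ≡ t₃ t

_∈₃?_ : ∀ {n} (x : Pair n) (t : Triple n) → Dec (x ∈₃ t)
x ∈₃? t = (x ≟ᴾ t₁ t) ⊎-dec ((x ≟ᴾ t₂ t) ⊎-dec (x ≟ᴾ t₃ t))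

degree : ∀ {n} → List (Triple n) → Pair n → ℕ
degree L x = length (filter (x ∈₃?_) L)

record IsConfiguration (n : ℕ) (L : List (Triple n)) : Set where
  field
    size3     : ∀ r → t₁ (lookup L r) ≢ t₂ (lookup L r)
                    × t₁ (lookup L r) ≢ t₃ (lookup L r)
                    × t₂ (lookup L r) ≢ t₃ (lookup L r)
    numLines  : length L ≡ n C 3
    pointDeg  : ∀ x → degree L x ≡ n ∸ 2
    partial   : ∀ r s → r ≢ s → ∀ x y →
                x ∈₃ lookup L r → y ∈₃ lookup L r →
                x ∈₃ lookup L s → y ∈₃ lookup L s → x ≡ y

-- In the 0-based encoding the index
-- j ∈ I_n is a value j : Fin n and I_{j-1} is Fin (toℕ j).  The entries for
-- j = 1, 2 are permutations of Fin 0 and Fin 1, hence forced to be the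
-- identity (φ_2 = id_{1} as in the paper; φ_1 is never used).

Perms : ℕ → Set
Perms n = (j : Fin n) → Permutation′ (toℕ j)

private
  lower-lt : ∀ {n} (j : Fin n) (x : Fin (toℕ j)) → inject x Fin.< j
  lower-lt j x = subst (ℕ._< toℕ j) (sym (toℕ-inject x)) (toℕ<n x)

σΦ : ∀ {n} → Perms n → Pair n → Pair n
σΦ Φ (pair i j i<j) = pair (inject y) j (lower-lt j y)
  where y = Φ j ⟨$⟩ʳ fromℕ< i<j

σΦ⁻¹ : ∀ {n} → Perms n → Pair n → Pair n
σΦ⁻¹ Φ (pair m j m<j) = pair (inject y) j (lower-lt j y)
  where y = Φ j ⟨$⟩ˡ fromℕ< m<j

data Point (n : ℕ) : Set where
  a b : Fin n → Point n
  p   : Point n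
  c   : Pair n → Point n

data Line (n : ℕ) (L : List (Triple n)) : Set where
  pab : Fin n → Line n L
  aa  : Pair n → Line n L
  bb  : Pair n → Line n L
  cc  : Fin (length L) → Line n L

Inc : ∀ {n} → Perms n → (L : List (Triple n)) → Point n → Line n L → Set
Inc Φ L x (pab i) = x ≡ p ⊎ x ≡ a i ⊎ x ≡ b i
Inc Φ L x (aa u)  = x ≡ a (lo u) ⊎ x ≡ a (hi u) ⊎ x ≡ c u
Inc Φ L x (bb u)  = x ≡ b (lo u) ⊎ x ≡ b (hi u) ⊎ x ≡ c (σΦ⁻¹ Φ u)
Inc Φ L x (cc r)  = x ≡ c (t₁ t) ⊎ x ≡ c (t₂ t) ⊎ x ≡ c (t₃ t)
  where t = lookup L r

LinesMeet : ∀ {n} → Perms n → (L : List (Triple n)) →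
            Point n → Point n → Point n → Point n → Set
LinesMeet Φ L x y z w =
  Σ (Line _ L) λ ℓ → Σ (Line _ L) λ ℓ' →
    Inc Φ L x ℓ × Inc Φ L y ℓ × Inc Φ L z ℓ' × Inc Φ L w ℓ' ×
    ∃ λ q → Inc Φ L q ℓ × Inc Φ L q ℓ'

module Submission where

open import Defs
open import Data.Nat as ℕ using (ℕ; suc; _<_; _≤_)
import Data.Nat.Properties as ℕ
open import Data.Fin as Fin using (Fin; toℕ; fromℕ<; inject)
open import Data.Fin.Properties
  using (toℕ-injective; toℕ-inject; toℕ-fromℕ<; toℕ<n; <-cmp; <⇒≢; <-asym; _<?_)
open import Data.Fin.Permutation using (_⟨$⟩ʳ_; _⟨$⟩ˡ_; inverseʳ; inverseˡ)
open import Data.List using (List)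
open import Data.Product using (Σ; _×_; _,_)
open import Data.Sum using (_⊎_; inj₁; inj₂)
open import Data.Empty using (⊥-elim)
open import Function using (_∘_)
open import Function.Bundles using (_⇔_; mk⇔; Equivalence)
open import Function.Construct.Composition using (_⇔-∘_)
open import Relation.Binary.Definitions using (tri<; tri≈; tri>)
open import Relation.Binary.PropositionalEquality
  using (_≡_; _≢_; refl; sym; trans; cong; subst; ≢-sym; module ≡-Reasoning)
open import Relation.Nullary using (yes; no; ¬_)
open import Relation.Nullary.Decidable using (recompute)

-- The only line through a_k and a_i is {a_k, a_i, c_u} with u = {k, i}, and the lines
-- through b_k and some b_j are the lines {b_k, b_j, c_{σ⁻¹ v}} with k ∈ v. Such lines can
-- only meet in a point c, so (i) holds for i exactly when k ∈ σ_Φ({k, i}). For i < k this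
-- is automatic, σ_Φ({i, k}) = {k, φ_k(i)}; for k < i we have σ_Φ({k, i}) = {i, φ_i(k)},
-- which contains k exactly when φ_i(k) = k.

data _∈ᴾ_ {n} (x : Fin n) (u : Pair n) : Set where
  lo∈ᴾ : x ≡ lo u → x ∈ᴾ u
  hi∈ᴾ : x ≡ hi u → x ∈ᴾ u

lo<hi : ∀ {n} (u : Pair n) → lo u Fin.< hi u
lo<hi (pair l h l<h) = recompute (l <? h) l<h

pair-≡ : ∀ {n} {u v : Pair n} → lo u ≡ lo v → hi u ≡ hi v → u ≡ v
pair-≡ {u = pair l h _} {v = pair .l .h _} refl refl = refl

∈ᴾ⇒≡pair : ∀ {n} {x y : Fin n} {u : Pair n} →
           x ∈ᴾ u → y ∈ᴾ u → (x<y : x Fin.< y) → u ≡ pair x y x<y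
∈ᴾ⇒≡pair (lo∈ᴾ refl) (hi∈ᴾ refl) _   = pair-≡ refl refl
∈ᴾ⇒≡pair (lo∈ᴾ refl) (lo∈ᴾ refl) x<y = ⊥-elim (<⇒≢ x<y refl)
∈ᴾ⇒≡pair (hi∈ᴾ refl) (hi∈ᴾ refl) x<y = ⊥-elim (<⇒≢ x<y refl)
∈ᴾ⇒≡pair {u = u} (hi∈ᴾ refl) (lo∈ᴾ refl) x<y = ⊥-elim (<-asym x<y (lo<hi u))

∈ᴾ-unique : ∀ {n} {x y : Fin n} {u w : Pair n} → x ≢ y →
            x ∈ᴾ u → y ∈ᴾ u → x ∈ᴾ w → y ∈ᴾ w → u ≡ w
∈ᴾ-unique {x = x} {y} x≢y xu yu xw yw with <-cmp x y
... | tri< x<y _ _ = trans (∈ᴾ⇒≡pair xu yu x<y) (sym (∈ᴾ⇒≡pair xw yw x<y))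
... | tri≈ _ x≡y _ = ⊥-elim (x≢y x≡y)
... | tri> _ _ y<x = trans (∈ᴾ⇒≡pair yu xu y<x) (sym (∈ᴾ⇒≡pair yw xw y<x))

∈ᴾ-partner : ∀ {n} {x : Fin n} {u : Pair n} → x ∈ᴾ u → Σ (Fin n) λ y → y ≢ x × y ∈ᴾ u
∈ᴾ-partner {u = u} (lo∈ᴾ refl) = hi u , ≢-sym (<⇒≢ (lo<hi u)) , hi∈ᴾ refl
∈ᴾ-partner {u = u} (hi∈ᴾ refl) = lo u , <⇒≢ (lo<hi u) , lo∈ᴾ refl

inject-fromℕ< : ∀ {n} {i j : Fin n} .(i<j : i Fin.< j) → inject {i = j} (fromℕ< i<j) ≡ i
inject-fromℕ< i<j = toℕ-injective (trans (toℕ-inject (fromℕ< i<j)) (toℕ-fromℕ< i<j))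

inject-< : ∀ {n} {j : Fin n} (y : Fin (toℕ j)) → inject y Fin.< j
inject-< {j = j} y = subst (ℕ._< toℕ j) (sym (toℕ-inject y)) (toℕ<n y)

fromℕ<-inject : ∀ {n} {j : Fin n} (y : Fin (toℕ j)) → fromℕ< (inject-< y) ≡ y
fromℕ<-inject y = toℕ-injective (trans (toℕ-fromℕ< (inject-< y)) (toℕ-inject y))

module _ {n : ℕ} (Φ : Perms n) where
  open ≡-Reasoning

  σΦ⁻¹-σΦ : (u : Pair n) → σΦ⁻¹ Φ (σΦ Φ u) ≡ u
  σΦ⁻¹-σΦ (pair i j i<j) = pair-≡ lo-eq refl
    where
    y = Φ j ⟨$⟩ʳ fromℕ< i<j
    lo-eq : inject (Φ j ⟨$⟩ˡ fromℕ< (inject-< y)) ≡ i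
    lo-eq = begin
      inject (Φ j ⟨$⟩ˡ fromℕ< (inject-< y)) ≡⟨ cong (inject ∘ (Φ j ⟨$⟩ˡ_)) (fromℕ<-inject y) ⟩
      inject (Φ j ⟨$⟩ˡ y)                   ≡⟨ cong inject (inverseˡ (Φ j)) ⟩
      inject (fromℕ< i<j)                   ≡⟨ inject-fromℕ< i<j ⟩
      i                                     ∎

  σΦ-σΦ⁻¹ : (v : Pair n) → σΦ Φ (σΦ⁻¹ Φ v) ≡ v
  σΦ-σΦ⁻¹ (pair m j m<j) = pair-≡ lo-eq refl
    where
    y = Φ j ⟨$⟩ˡ fromℕ< m<j
    lo-eq : inject (Φ j ⟨$⟩ʳ fromℕ< (inject-< y)) ≡ m
    lo-eq = begin
      inject (Φ j ⟨$⟩ʳ fromℕ< (inject-< y)) ≡⟨ cong (inject ∘ (Φ j ⟨$⟩ʳ_)) (fromℕ<-inject y) ⟩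
      inject (Φ j ⟨$⟩ʳ y)                   ≡⟨ cong inject (inverseʳ (Φ j)) ⟩
      inject (fromℕ< m<j)                   ≡⟨ inject-fromℕ< m<j ⟩
      m                                     ∎

  ∈σΦ-lo⇔fixed : ∀ {k j : Fin n} (k<j : k Fin.< j) →
                 k ∈ᴾ σΦ Φ (pair k j k<j) ⇔ Φ j ⟨$⟩ʳ fromℕ< k<j ≡ fromℕ< k<j
  ∈σΦ-lo⇔fixed {k} {j} k<j = mk⇔ to from
    where
    y = Φ j ⟨$⟩ʳ fromℕ< k<j
    to : k ∈ᴾ σΦ Φ (pair k j k<j) → y ≡ fromℕ< k<j
    to (lo∈ᴾ k≡y) = toℕ-injective (begin
      toℕ y            ≡⟨ sym (toℕ-inject y) ⟩
      toℕ (inject y)   ≡⟨ cong toℕ (sym k≡y) ⟩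
      toℕ k            ≡⟨ sym (toℕ-fromℕ< k<j) ⟩
      toℕ (fromℕ< k<j) ∎)
    to (hi∈ᴾ k≡j) = ⊥-elim (<⇒≢ k<j k≡j)
    from : y ≡ fromℕ< k<j → k ∈ᴾ σΦ Φ (pair k j k<j)
    from y-fixed = lo∈ᴾ (sym (trans (cong inject y-fixed) (inject-fromℕ< k<j)))

module _ {n : ℕ} (Φ : Perms n) (𝔑 : List (Triple n)) where

  line-through-a : ∀ {x y : Fin n} {ℓ : Line n 𝔑} → x ≢ y →
                   Inc Φ 𝔑 (a x) ℓ → Inc Φ 𝔑 (a y) ℓ →
                   Σ (Pair n) λ u → ℓ ≡ aa u × x ∈ᴾ u × y ∈ᴾ u
  line-through-a {ℓ = pab _} x≢y (inj₂ (inj₁ refl)) (inj₂ (inj₁ refl)) = ⊥-elim (x≢y refl)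
  line-through-a {ℓ = aa u} _ (inj₁ refl)        (inj₁ refl)        = u , refl , lo∈ᴾ refl , lo∈ᴾ refl
  line-through-a {ℓ = aa u} _ (inj₁ refl)        (inj₂ (inj₁ refl)) = u , refl , lo∈ᴾ refl , hi∈ᴾ refl
  line-through-a {ℓ = aa u} _ (inj₂ (inj₁ refl)) (inj₁ refl)        = u , refl , hi∈ᴾ refl , lo∈ᴾ refl
  line-through-a {ℓ = aa u} _ (inj₂ (inj₁ refl)) (inj₂ (inj₁ refl)) = u , refl , hi∈ᴾ refl , hi∈ᴾ refl
  line-through-a {ℓ = pab _} _ (inj₁ ()) _
  line-through-a {ℓ = pab _} _ (inj₂ (inj₂ ())) _
  line-through-a {ℓ = pab _} _ _ (inj₁ ())
  line-through-a {ℓ = pab _} _ _ (inj₂ (inj₂ ()))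
  line-through-a {ℓ = aa _} _ (inj₂ (inj₂ ())) _
  line-through-a {ℓ = aa _} _ _ (inj₂ (inj₂ ()))
  line-through-a {ℓ = bb _} _ (inj₁ ()) _
  line-through-a {ℓ = bb _} _ (inj₂ (inj₁ ())) _
  line-through-a {ℓ = bb _} _ (inj₂ (inj₂ ())) _
  line-through-a {ℓ = cc _} _ (inj₁ ()) _
  line-through-a {ℓ = cc _} _ (inj₂ (inj₁ ())) _
  line-through-a {ℓ = cc _} _ (inj₂ (inj₂ ())) _

  line-through-b : ∀ {x y : Fin n} {ℓ : Line n 𝔑} → x ≢ y →
                   Inc Φ 𝔑 (b x) ℓ → Inc Φ 𝔑 (b y) ℓ →
                   Σ (Pair n) λ v → ℓ ≡ bb v × x ∈ᴾ v × y ∈ᴾ v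
  line-through-b {ℓ = pab _} x≢y (inj₂ (inj₂ refl)) (inj₂ (inj₂ refl)) = ⊥-elim (x≢y refl)
  line-through-b {ℓ = bb v} _ (inj₁ refl)        (inj₁ refl)        = v , refl , lo∈ᴾ refl , lo∈ᴾ refl
  line-through-b {ℓ = bb v} _ (inj₁ refl)        (inj₂ (inj₁ refl)) = v , refl , lo∈ᴾ refl , hi∈ᴾ refl
  line-through-b {ℓ = bb v} _ (inj₂ (inj₁ refl)) (inj₁ refl)        = v , refl , hi∈ᴾ refl , lo∈ᴾ refl
  line-through-b {ℓ = bb v} _ (inj₂ (inj₁ refl)) (inj₂ (inj₁ refl)) = v , refl , hi∈ᴾ refl , hi∈ᴾ refl
  line-through-b {ℓ = pab _} _ (inj₁ ()) _
  line-through-b {ℓ = pab _} _ (inj₂ (inj₁ ())) _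
  line-through-b {ℓ = pab _} _ _ (inj₁ ())
  line-through-b {ℓ = pab _} _ _ (inj₂ (inj₁ ()))
  line-through-b {ℓ = bb _} _ (inj₂ (inj₂ ())) _
  line-through-b {ℓ = bb _} _ _ (inj₂ (inj₂ ()))
  line-through-b {ℓ = aa _} _ (inj₁ ()) _
  line-through-b {ℓ = aa _} _ (inj₂ (inj₁ ())) _
  line-through-b {ℓ = aa _} _ (inj₂ (inj₂ ())) _
  line-through-b {ℓ = cc _} _ (inj₁ ()) _
  line-through-b {ℓ = cc _} _ (inj₂ (inj₁ ())) _
  line-through-b {ℓ = cc _} _ (inj₂ (inj₂ ())) _

  aa-bb-meet⇒≡σΦ⁻¹ : ∀ {q : Point n} {u v : Pair n} →
                     Inc Φ 𝔑 q (aa u) → Inc Φ 𝔑 q (bb v) → u ≡ σΦ⁻¹ Φ v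
  aa-bb-meet⇒≡σΦ⁻¹ (inj₂ (inj₂ refl)) (inj₂ (inj₂ refl)) = refl
  aa-bb-meet⇒≡σΦ⁻¹ (inj₁ refl)        (inj₁ ())
  aa-bb-meet⇒≡σΦ⁻¹ (inj₁ refl)        (inj₂ (inj₁ ()))
  aa-bb-meet⇒≡σΦ⁻¹ (inj₁ refl)        (inj₂ (inj₂ ()))
  aa-bb-meet⇒≡σΦ⁻¹ (inj₂ (inj₁ refl)) (inj₁ ())
  aa-bb-meet⇒≡σΦ⁻¹ (inj₂ (inj₁ refl)) (inj₂ (inj₁ ()))
  aa-bb-meet⇒≡σΦ⁻¹ (inj₂ (inj₁ refl)) (inj₂ (inj₂ ()))
  aa-bb-meet⇒≡σΦ⁻¹ (inj₂ (inj₂ refl)) (inj₁ ())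
  aa-bb-meet⇒≡σΦ⁻¹ (inj₂ (inj₂ refl)) (inj₂ (inj₁ ()))

  ∈ᴾ⇒a-on-aa : ∀ {x : Fin n} {u : Pair n} → x ∈ᴾ u → Inc Φ 𝔑 (a x) (aa u)
  ∈ᴾ⇒a-on-aa (lo∈ᴾ refl) = inj₁ refl
  ∈ᴾ⇒a-on-aa (hi∈ᴾ refl) = inj₂ (inj₁ refl)

  ∈ᴾ⇒b-on-bb : ∀ {x : Fin n} {v : Pair n} → x ∈ᴾ v → Inc Φ 𝔑 (b x) (bb v)
  ∈ᴾ⇒b-on-bb (lo∈ᴾ refl) = inj₁ refl
  ∈ᴾ⇒b-on-bb (hi∈ᴾ refl) = inj₂ (inj₁ refl)

  ABLinesMeet : Fin n → Fin n → Set
  ABLinesMeet k i = Σ (Fin n) λ j → j ≢ k × LinesMeet Φ 𝔑 (a k) (a i) (b k) (b j)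

  abLinesMeet⇔∈σΦ : ∀ {k i : Fin n} (u : Pair n) → k ≢ i → k ∈ᴾ u → i ∈ᴾ u →
                    ABLinesMeet k i ⇔ k ∈ᴾ σΦ Φ u
  abLinesMeet⇔∈σΦ {k} {i} u k≢i k∈u i∈u = mk⇔ to from
    where
    open ≡-Reasoning
    to : ABLinesMeet k i → k ∈ᴾ σΦ Φ u
    to (j , j≢k , ℓ , ℓ′ , akℓ , aiℓ , bkℓ′ , bjℓ′ , q , qℓ , qℓ′)
      with line-through-a k≢i akℓ aiℓ | line-through-b (≢-sym j≢k) bkℓ′ bjℓ′
    ... | u′ , refl , k∈u′ , i∈u′ | v , refl , k∈v , _ = subst (k ∈ᴾ_) (sym σu≡v) k∈v
      where
      σu≡v : σΦ Φ u ≡ v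
      σu≡v = begin
        σΦ Φ u          ≡⟨ cong (σΦ Φ) (∈ᴾ-unique k≢i k∈u i∈u k∈u′ i∈u′) ⟩
        σΦ Φ u′         ≡⟨ cong (σΦ Φ) (aa-bb-meet⇒≡σΦ⁻¹ qℓ qℓ′) ⟩
        σΦ Φ (σΦ⁻¹ Φ v) ≡⟨ σΦ-σΦ⁻¹ Φ v ⟩
        v               ∎
    from : k ∈ᴾ σΦ Φ u → ABLinesMeet k i
    from k∈σu with ∈ᴾ-partner k∈σu
    ... | j , j≢k , j∈σu =
      j , j≢k , aa u , bb (σΦ Φ u) ,
      ∈ᴾ⇒a-on-aa k∈u , ∈ᴾ⇒a-on-aa i∈u , ∈ᴾ⇒b-on-bb k∈σu , ∈ᴾ⇒b-on-bb j∈σu ,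
      c u , inj₂ (inj₂ refl) , inj₂ (inj₂ (cong c (sym (σΦ⁻¹-σΦ Φ u))))

  abLinesMeet-below : ∀ {i k : Fin n} → i Fin.< k → ABLinesMeet k i
  abLinesMeet-below {i} {k} i<k =
    Equivalence.from (abLinesMeet⇔∈σΦ (pair i k i<k) (≢-sym (<⇒≢ i<k)) (hi∈ᴾ refl) (lo∈ᴾ refl))
      (hi∈ᴾ refl)

  abLinesMeet-above⇔fixed : ∀ {k j : Fin n} (k<j : k Fin.< j) →
                            ABLinesMeet k j ⇔ Φ j ⟨$⟩ʳ fromℕ< k<j ≡ fromℕ< k<j
  abLinesMeet-above⇔fixed {k} {j} k<j =
    ∈σΦ-lo⇔fixed Φ k<j ⇔-∘ abLinesMeet⇔∈σΦ (pair k j k<j) (<⇒≢ k<j) (lo∈ᴾ refl) (hi∈ᴾ refl)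

FixedByAllAbove : ∀ {n} → Perms n → Fin n → Set
FixedByAllAbove {n} Φ k = (j : Fin n) (k<j : k Fin.< j) → Φ j ⟨$⟩ʳ fromℕ< k<j ≡ fromℕ< k<j

nothing-above-last : ∀ {n} {k j : Fin n} → suc (toℕ k) ≡ n → ¬ (k Fin.< j)
nothing-above-last {j = j} k-last k<j =
  ℕ.<-irrefl refl (ℕ.<-≤-trans (toℕ<n j) (subst (_≤ toℕ j) k-last k<j))

lemma2p11 : (n : ℕ) → 3 < n →
    (𝔑 : List (Triple n)) → IsConfiguration n 𝔑 →
    (Φ : Perms n) →
    (k : Fin n) → 3 ≤ toℕ k →
    ((i : Fin n) → i ≢ k → Σ (Fin n) λ j → j ≢ k × LinesMeet Φ 𝔑 (a k) (a i) (b k) (b j))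
    ⇔ (suc (toℕ k) ≡ n
       ⊎ (suc (toℕ k) < n × ((j : Fin n) → (k<j : k Fin.< j) → Φ j ⟨$⟩ʳ fromℕ< k<j ≡ fromℕ< k<j)))
lemma2p11 n _ 𝔑 _ Φ k _ = mk⇔ to from
  where
  to : (∀ i → i ≢ k → ABLinesMeet Φ 𝔑 k i) →
       suc (toℕ k) ≡ n ⊎ (suc (toℕ k) < n × FixedByAllAbove Φ k)
  to meets with suc (toℕ k) ℕ.≟ n
  ... | yes k-last     = inj₁ k-last
  ... | no  k-not-last = inj₂ (ℕ.≤∧≢⇒< (toℕ<n k) k-not-last , λ j k<j →
    Equivalence.to (abLinesMeet-above⇔fixed Φ 𝔑 k<j) (meets j (≢-sym (<⇒≢ k<j))))
  from : suc (toℕ k) ≡ n ⊎ (suc (toℕ k) < n × FixedByAllAbove Φ k) →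
         ∀ i → i ≢ k → ABLinesMeet Φ 𝔑 k i
  from fixes i i≢k with <-cmp i k
  ... | tri< i<k _ _ = abLinesMeet-below Φ 𝔑 i<k
  ... | tri≈ _ i≡k _ = ⊥-elim (i≢k i≡k)
  ... | tri> _ _ k<i with fixes
  ...   | inj₁ k-last      = ⊥-elim (nothing-above-last k-last k<i)
  ...   | inj₂ (_ , fixed)  = Equivalence.from (abLinesMeet-above⇔fixed Φ 𝔑 k<i) (fixed i k<i)
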